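{- Let $r\ge0$, let $\gamma\in1\{0,1\}^*\cup\{\varepsilon\}$, and let $\gamma'=10^r\gamma$. Then for all $i=0,1,\dots,|\gamma'|$, $$F(\gamma',i)=\begin{cases}\max\big(P(\gamma',i),F(\gamma,i)\big) & \text{if } i\le|\gamma|,\\ \max\big(P(\gamma',i),F(\gamma,|\gamma|)\big) & \text{if } i>|\gamma|.\end{cases}$$
   Context: For a binary word $x$ and $0\le k\le|x|$, let $P(x,k)$ be the number of $1$s in the length-$k$ prefix of $x$. Let $F(x,k)$ be the maximum number of $1$s in a length-$k$ substring (contiguous factor) of $x$. $\varepsilon$ denotes the empty word. -}

module Defs where

open import Data.Bool using (Bool; true; false)
open import Data.Nat using (ℕ; zero; suc; _+_; _⊔_; _≤_)
open import Data.List using (List; []; _∷_; take; drop; length; replicate; _++_)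

-- Binary words are lists of Bool (true = 1, false = 0).
Word : Set
Word = List Bool

ones : Word → ℕ
ones [] = 0
ones (true ∷ w) = suc (ones w)
ones (false ∷ w) = ones w

P : Word → ℕ → ℕ
P x k = ones (take k x)

-- maximum number of 1s in a length-k factor starting at positions 0..|x|-k.
-- maxFrom x k computes the maximum over all suffixes s of x with |s| ≥ k
-- of ones (take k s); returns 0 if no such suffix (only when k > |x|).
maxFrom : Word → ℕ → ℕ
maxFrom [] zero = 0
maxFrom [] (suc k) = 0
maxFrom (b ∷ w) k with k Data.Nat.≤ᵇ length (b ∷ w)
... | true = ones (take k (b ∷ w)) ⊔ maxFrom w k
... | false = 0

-- F(x,k): maximum number of 1s in a length-k contiguous factor of x
-- (meaningful for 0 ≤ k ≤ |x|).
F : Word → ℕ → ℕ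
F x k = maxFrom x k

-- Only the first window of 1 0^r γ starts with a 1.  A window starting at a 0
-- has no more 1s than the window one step to the right, so the windows inside
-- the block 0^r contribute nothing beyond the windows of γ when they fit into γ;
-- when they do not, they all contain γ entirely and so carry exactly its 1s.
module Submission where

open import Defs
open import Data.Bool using (true; false; T)
open import Data.Nat using (ℕ; zero; suc; _≤_; _<_; _>_; _⊔_; _≤ᵇ_; z≤n; s≤s)
open import Data.Nat.Properties
open import Data.List using ([]; _∷_; length; replicate; _++_; take)
open import Data.List.Properties using (take-all; length-++-≤ʳ)
open import Data.Product using (∃; _×_; _,_)
open import Data.Sum using (_⊎_; inj₁; inj₂)
open import Relation.Nullary using (contradiction)
open import Relation.Binary.PropositionalEquality

ones-zeros++ : ∀ m w → ones (replicate m false ++ w) ≡ ones w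
ones-zeros++ zero    w = refl
ones-zeros++ (suc m) w = ones-zeros++ m w

ones-take-suc : ∀ k w → ones (take k w) ≤ ones (take (suc k) w)
ones-take-suc zero    []          = z≤n
ones-take-suc (suc k) []          = z≤n
ones-take-suc zero    (true ∷ w)  = z≤n
ones-take-suc zero    (false ∷ w) = z≤n
ones-take-suc (suc k) (true ∷ w)  = s≤s (ones-take-suc k w)
ones-take-suc (suc k) (false ∷ w) = ones-take-suc k w

ones-take-false∷ : ∀ k w → ones (take k (false ∷ w)) ≤ ones (take k w)
ones-take-false∷ zero    w = z≤n
ones-take-false∷ (suc k) w = ones-take-suc k w

maxFrom-∷ : ∀ b w k → k ≤ length (b ∷ w) →
            maxFrom (b ∷ w) k ≡ ones (take k (b ∷ w)) ⊔ maxFrom w k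
maxFrom-∷ b w k k≤ with k ≤ᵇ length (b ∷ w) | ≤⇒≤ᵇ k≤
... | true | _ = refl

maxFrom-> : ∀ w k → length w < k → maxFrom w k ≡ 0
maxFrom-> []      zero    _ = refl
maxFrom-> []      (suc k) _ = refl
maxFrom-> (b ∷ w) k       w<k with k ≤ᵇ length (b ∷ w) in eq
... | false = refl
... | true  = contradiction (≤ᵇ⇒≤ k (length (b ∷ w)) (subst T (sym eq) _)) (<⇒≱ w<k)

ones-take≤maxFrom : ∀ w k → k ≤ length w → ones (take k w) ≤ maxFrom w k
ones-take≤maxFrom []      zero k≤ = z≤n
ones-take≤maxFrom (b ∷ w) k    k≤ rewrite maxFrom-∷ b w k k≤ = m≤m⊔n _ _

maxFrom-length : ∀ w → maxFrom w (length w) ≡ ones w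
maxFrom-length []      = refl
maxFrom-length (b ∷ w) = begin
  maxFrom (b ∷ w) (length (b ∷ w))                     ≡⟨ maxFrom-∷ b w _ ≤-refl ⟩
  ones (take (length (b ∷ w)) (b ∷ w)) ⊔ maxFrom w _  ≡⟨ cong₂ _⊔_ (cong ones (take-all _ (b ∷ w) ≤-refl))
                                                                    (maxFrom-> w _ ≤-refl) ⟩
  ones (b ∷ w) ⊔ 0                                     ≡⟨ ⊔-identityʳ _ ⟩
  ones (b ∷ w)                                         ∎
  where open ≡-Reasoning

maxFrom-false∷ : ∀ w k → k ≤ length w → maxFrom (false ∷ w) k ≡ maxFrom w k
maxFrom-false∷ w k k≤ = trans (maxFrom-∷ false w k (m≤n⇒m≤1+n k≤))
  (m≤n⇒m⊔n≡n (≤-trans (ones-take-false∷ k w) (ones-take≤maxFrom w k k≤)))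

maxFrom-zeros++ : ∀ m w k → k ≤ length w → maxFrom (replicate m false ++ w) k ≡ maxFrom w k
maxFrom-zeros++ zero    w k k≤ = refl
maxFrom-zeros++ (suc m) w k k≤ =
  trans (maxFrom-false∷ _ k (≤-trans k≤ (length-++-≤ʳ w {replicate m false}))) (maxFrom-zeros++ m w k k≤)

maxFrom-zeros++-long : ∀ m w k → length w ≤ k → k ≤ length (replicate m false ++ w) →
                       maxFrom (replicate m false ++ w) k ≡ ones w
maxFrom-zeros++-long zero    w k w≤k k≤ rewrite ≤-antisym k≤ w≤k = maxFrom-length w
maxFrom-zeros++-long (suc m) w k w≤k k≤ with m≤n⇒m<n∨m≡n k≤
... | inj₁ k<  = trans (maxFrom-false∷ _ k (m<1+n⇒m≤n k<))
                       (maxFrom-zeros++-long m w k w≤k (m<1+n⇒m≤n k<))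
... | inj₂ refl = trans (maxFrom-length (replicate (suc m) false ++ w)) (ones-zeros++ m w)

lemma3 : (r : ℕ) (γ : Word) → (γ ≡ [] ⊎ ∃ λ δ → γ ≡ true ∷ δ) →
    (i : ℕ) → i ≤ length (true ∷ replicate r false ++ γ) →
    (i ≤ length γ → F (true ∷ replicate r false ++ γ) i ≡ P (true ∷ replicate r false ++ γ) i ⊔ F γ i)
    × (i > length γ → F (true ∷ replicate r false ++ γ) i ≡ P (true ∷ replicate r false ++ γ) i ⊔ F γ (length γ))
lemma3 r γ _ i i≤ = short , long
  where
  γ′ : Word
  γ′ = true ∷ replicate r false ++ γ

  firstWindow : F γ′ i ≡ P γ′ i ⊔ maxFrom (replicate r false ++ γ) i
  firstWindow = maxFrom-∷ true _ i i≤

  short : i ≤ length γ → F γ′ i ≡ P γ′ i ⊔ F γ i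
  short i≤γ = trans firstWindow (cong (P γ′ i ⊔_) (maxFrom-zeros++ r γ i i≤γ))

  long : i > length γ → F γ′ i ≡ P γ′ i ⊔ F γ (length γ)
  long γ<i with m≤n⇒m<n∨m≡n i≤
  ... | inj₁ i< = trans firstWindow (cong (P γ′ i ⊔_)
    (trans (maxFrom-zeros++-long r γ i (<⇒≤ γ<i) (m<1+n⇒m≤n i<)) (sym (maxFrom-length γ))))
  ... | inj₂ refl = begin
    F γ′ (length γ′)                   ≡⟨ maxFrom-length γ′ ⟩
    ones γ′                            ≡⟨ m≥n⇒m⊔n≡m ones-γ≤ones-γ′ ⟨
    ones γ′ ⊔ ones γ                   ≡⟨ cong₂ _⊔_ (cong ones (take-all _ γ′ ≤-refl)) (maxFrom-length γ) ⟨
    P γ′ (length γ′) ⊔ F γ (length γ)  ∎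
    where
    open ≡-Reasoning
    ones-γ≤ones-γ′ : ones γ ≤ ones γ′
    ones-γ≤ones-γ′ = ≤-trans (≤-reflexive (sym (ones-zeros++ r γ))) (n≤1+n _)
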